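{- Let $\mathcal{P}$ be a finite poset, $D\subseteq\mathcal{P}$ and $I\subseteq\mathcal{P}\setminus D$, and let $\mathcal{C}_{D,I}$ be the set of all ordered pairs $(A,B)$ of antichains of $\mathcal{P}$ with $A\triangle B=D$ and $A\cap B=I$. Suppose $\mathcal{C}_{D,I}\neq\emptyset$. Let $\mathcal{K}$ be the set of connected components of the subposet $\mathcal{P}[D]$ induced by $D$. Then the pairs in $\mathcal{C}_{D,I}$ are in bijection with the subsets of $\mathcal{K}$; in particular $|\mathcal{C}_{D,I}|=2^{|\mathcal{K}|}$.
   Context: Connected components of $\mathcal{P}[D]$ are those of its comparability graph. -}

module Defs where

open import Level using (Level)
open import Data.Nat using (ℕ)
open import Data.Fin using (Fin)
open import Data.Fin.Subset using (Subset; _∈_; _∉_; _∩_; _∪_; _─_)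
open import Data.Product using (Σ; ∃; _×_; _,_)
open import Data.Sum using (_⊎_)
open import Relation.Binary using (Rel; IsPartialOrder)
open import Relation.Binary.PropositionalEquality using (_≡_)
open import Relation.Binary.Construct.Closure.ReflexiveTransitive using (Star)

-- A finite poset is modelled as Fin n with a partial order _≤_ (w.r.t. ≡).
module _ {ℓ : Level} {n : ℕ} (_≤_ : Rel (Fin n) ℓ) where

  IsAntichain : Subset n → Set ℓ
  IsAntichain A = ∀ x y → x ∈ A → y ∈ A → x ≤ y → x ≡ y

  _△_ : Subset n → Subset n → Subset n
  A △ B = (A ─ B) ∪ (B ─ A)

  InC : Subset n → Subset n → Subset n × Subset n → Set ℓ
  InC D I (A , B) = IsAntichain A × IsAntichain B × (A △ B ≡ D) × (A ∩ B ≡ I)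

  Comparable : Subset n → Rel (Fin n) ℓ
  Comparable D x y = x ∈ D × y ∈ D × (x ≤ y ⊎ y ≤ x)

  Connected : Subset n → Rel (Fin n) ℓ
  Connected D = Star (Comparable D)

  -- S is a connected component of P[D] (i.e. of its comparability graph):
  -- a nonempty subset of D, internally connected, closed under connectedness.
  IsComponent : Subset n → Subset n → Set ℓ
  IsComponent D S =
    (∀ x → x ∈ S → x ∈ D) ×
    (∃ λ x → x ∈ S) ×
    (∀ x y → x ∈ S → y ∈ S → Connected D x y) ×
    (∀ x y → x ∈ S → Connected D x y → y ∈ S)

module Submission where

open import Defs
open import Level using (Level)
open import Data.Nat using (ℕ)
open import Data.Fin using (Fin)
open import Data.Fin.Subset using (Subset; _∈_; _∉_)
open import Data.List using (List; length)
open import Data.List.Relation.Unary.Unique.Propositional using (Unique)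
open import Data.Product using (Σ; ∃; _×_; _,_)
open import Function.Definitions using (Injective)
open import Function.Bundles using (_⇔_)
open import Relation.Binary using (Rel; IsPartialOrder)
open import Relation.Binary.PropositionalEquality using (_≡_)
import Data.List.Membership.Propositional as L

open import Data.Bool using (Bool; true; false; not; _∧_; _xor_; if_then_else_)
open import Data.Bool.Properties using (xor-assoc; xor-same; xor-identityʳ; xor-annihilates-not; not-¬)
open import Data.Empty using (⊥-elim)
open import Data.Fin using (zero; suc; _≟_)
open import Data.Fin.Properties using (any?)
open import Data.Fin.Subset using (_─_; _∪_; _∩_)
open import Data.Fin.Subset.Properties using (_∈?_; ⊆-antisym)
import Data.List as List
open import Data.List.Membership.Propositional.Properties using (∈-lookup)
import Data.List.Relation.Unary.All as All
open import Data.List.Relation.Unary.Any using (index)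
open import Data.List.Relation.Unary.Any.Properties using (lookup-index)
open import Data.List.Relation.Unary.AllPairs using (_∷_)
open import Data.Product using (proj₁; proj₂)
open import Data.Sum using (_⊎_; inj₁; inj₂)
open import Data.Vec using (_∷_; lookup; tabulate)
open import Data.Vec.Properties
  using ([]=⇒lookup; lookup⇒[]=; lookup∘tabulate; tabulate∘lookup; tabulate-cong; lookup-zipWith)
open import Function using (_∘_)
open import Function.Bundles using (module Equivalence)
open import Relation.Binary.Construct.Closure.ReflexiveTransitive using (Star; ε; _◅_; _◅◅_; reverse)
open import Relation.Binary.PropositionalEquality using (refl; sym; trans; cong; cong₂; subst; _≢_; module ≡-Reasoning)
open import Relation.Nullary using (Dec; yes; no; does; ¬_)
open import Relation.Nullary.Decidable using (_×-dec_; decidable-stable; ¬¬-excluded-middle; dec-true)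
open import Relation.Nullary.Negation using (DoubleNegation; contradiction)
open import Relation.Unary using (Pred; Decidable)

-- Fix one pair (A₀ , B₀) in C_{D,I}. Off D every pair of C_{D,I} agrees with I, and on D its
-- second set is the complement of its first, so a pair is determined by its first set A. Along
-- an edge x ≤ y of P[D] with x ≢ y, the antichain conditions force A to contain exactly one of
-- x, y; hence A △ A₀ is a union of components of P[D]. Conversely, exchanging A₀ and B₀ on any
-- union of components keeps both sets antichains, which gives the inverse bijection.

xor-cancelʳ : ∀ a b → (a xor b) xor b ≡ a
xor-cancelʳ a b = trans (xor-assoc a b b) (trans (cong (a xor_) (xor-same b)) (xor-identityʳ a))

xor≡true⇒≡not : ∀ {a b} → a xor b ≡ true → b ≡ not a
xor≡true⇒≡not {true}  {false} _ = refl
xor≡true⇒≡not {false} {true}  _ = refl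

xor≡false⇒≡∧ : ∀ {a b i} → a xor b ≡ false → a ∧ b ≡ i → a ≡ i × b ≡ i
xor≡false⇒≡∧ {true}  {true}  _ refl = refl , refl
xor≡false⇒≡∧ {false} {false} _ refl = refl , refl

if-xor-if : ∀ s a b → (if s then b else a) xor (if s then a else b) ≡ a xor b
if-xor-if true  true  true  = refl
if-xor-if true  true  false = refl
if-xor-if true  false true  = refl
if-xor-if true  false false = refl
if-xor-if false a     b     = refl

if-∧-if : ∀ s a b → (if s then b else a) ∧ (if s then a else b) ≡ a ∧ b
if-∧-if true  true  true  = refl
if-∧-if true  true  false = refl
if-∧-if true  false true  = refl
if-∧-if true  false false = refl
if-∧-if false a     b     = refl

if-not≡xor : ∀ s a → (if s then not a else a) ≡ s xor a
if-not≡xor true  a = refl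
if-not≡xor false a = refl

if-≡ : ∀ s {a b c : Bool} → a ≡ c → b ≡ c → (if s then b else a) ≡ c
if-≡ true  _ b≡c = b≡c
if-≡ false a≡c _ = a≡c

module _ {n : ℕ} where

  subset-ext : {A B : Subset n} → (∀ x → lookup A x ≡ lookup B x) → A ≡ B
  subset-ext {A} {B} eq = trans (sym (tabulate∘lookup A)) (trans (tabulate-cong eq) (tabulate∘lookup B))

  ∉⇒lookup≡false : ∀ {A : Subset n} {x} → x ∉ A → lookup A x ≡ false
  ∉⇒lookup≡false {A} {x} x∉A with lookup A x in eq
  ... | true  = contradiction (lookup⇒[]= x A eq) x∉A
  ... | false = refl

  ∈-tabulate⁺ : ∀ {p} {P : Pred (Fin n) p} (P? : Decidable P) {x} → P x → x ∈ tabulate (does ∘ P?)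
  ∈-tabulate⁺ P? {x} px = lookup⇒[]= x _ (trans (lookup∘tabulate _ x) (dec-true (P? x) px))

  ∈-tabulate⁻ : ∀ {p} {P : Pred (Fin n) p} (P? : Decidable P) {x} → x ∈ tabulate (does ∘ P?) → P x
  ∈-tabulate⁻ P? {x} x∈ with P? x | trans (sym (lookup∘tabulate _ x)) ([]=⇒lookup x∈)
  ... | yes px | _ = px

lookup-△ : ∀ {n} (A B : Subset n) x → lookup ((A ─ B) ∪ (B ─ A)) x ≡ lookup A x xor lookup B x
lookup-△ (true  ∷ A) (true  ∷ B) zero    = refl
lookup-△ (true  ∷ A) (false ∷ B) zero    = refl
lookup-△ (false ∷ A) (true  ∷ B) zero    = refl
lookup-△ (false ∷ A) (false ∷ B) zero    = refl
lookup-△ (_ ∷ A)     (_ ∷ B)     (suc x) = lookup-△ A B x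

switch : ∀ {n} → (Fin n → Bool) → Subset n → Subset n → Subset n
switch s P Q = tabulate λ x → if s x then lookup Q x else lookup P x

lookup-switch : ∀ {n} s (P Q : Subset n) x → lookup (switch s P Q) x ≡ (if s x then lookup Q x else lookup P x)
lookup-switch s P Q x = lookup∘tabulate _ x

switch-∈ : ∀ {n} s {P Q : Subset n} {x} → x ∈ switch s P Q → x ∈ (if s x then Q else P)
switch-∈ s {P} {Q} {x} x∈ with s x | trans (sym (lookup-switch s P Q x)) ([]=⇒lookup x∈)
... | true  | Qx = lookup⇒[]= x Q Qx
... | false | Px = lookup⇒[]= x P Px

switch-△-switch : ∀ {n} s (P Q : Subset n) →
                  (switch s P Q ─ switch s Q P) ∪ (switch s Q P ─ switch s P Q) ≡ (P ─ Q) ∪ (Q ─ P)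
switch-△-switch s P Q = subset-ext λ x → begin
  lookup ((switch s P Q ─ switch s Q P) ∪ (switch s Q P ─ switch s P Q)) x
    ≡⟨ lookup-△ (switch s P Q) (switch s Q P) x ⟩
  lookup (switch s P Q) x xor lookup (switch s Q P) x
    ≡⟨ cong₂ _xor_ (lookup-switch s P Q x) (lookup-switch s Q P x) ⟩
  (if s x then lookup Q x else lookup P x) xor (if s x then lookup P x else lookup Q x)
    ≡⟨ if-xor-if (s x) (lookup P x) (lookup Q x) ⟩
  lookup P x xor lookup Q x
    ≡⟨ lookup-△ P Q x ⟨
  lookup ((P ─ Q) ∪ (Q ─ P)) x ∎
  where open ≡-Reasoning

switch-∩-switch : ∀ {n} s (P Q : Subset n) → switch s P Q ∩ switch s Q P ≡ P ∩ Q
switch-∩-switch s P Q = subset-ext λ x → begin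
  lookup (switch s P Q ∩ switch s Q P) x
    ≡⟨ lookup-zipWith _∧_ x (switch s P Q) (switch s Q P) ⟩
  lookup (switch s P Q) x ∧ lookup (switch s Q P) x
    ≡⟨ cong₂ _∧_ (lookup-switch s P Q x) (lookup-switch s Q P x) ⟩
  (if s x then lookup Q x else lookup P x) ∧ (if s x then lookup P x else lookup Q x)
    ≡⟨ if-∧-if (s x) (lookup P x) (lookup Q x) ⟩
  lookup P x ∧ lookup Q x
    ≡⟨ lookup-zipWith _∧_ x P Q ⟨
  lookup (P ∩ Q) x ∎
  where open ≡-Reasoning

¬¬-decidable : ∀ {n p} {P : Pred (Fin n) p} → DoubleNegation (Decidable P)
¬¬-decidable {n = ℕ.zero} ¬P? = ¬P? λ ()
¬¬-decidable {n = ℕ.suc n} {P = P} ¬P? =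
  ¬¬-excluded-middle λ P₀? → ¬¬-decidable {P = P ∘ suc} λ Pₛ? →
    ¬P? λ { zero → P₀? ; (suc i) → Pₛ? i }

Unique-lookup-injective : ∀ {a} {A : Set a} {xs : List A} → Unique xs →
                          ∀ i j → List.lookup xs i ≡ List.lookup xs j → i ≡ j
Unique-lookup-injective (_ ∷ _)      zero    zero    _  = refl
Unique-lookup-injective (x≢ ∷ _)     zero    (suc j) eq = ⊥-elim (All.lookup x≢ (∈-lookup j) eq)
Unique-lookup-injective (x≢ ∷ _)     (suc i) zero    eq = ⊥-elim (All.lookup x≢ (∈-lookup i) (sym eq))
Unique-lookup-injective (_ ∷ unique) (suc i) (suc j) eq = cong suc (Unique-lookup-injective unique i j eq)

Star-invariant : ∀ {a b t} {A : Set a} {B : Set b} {T : Rel A t} (f : A → B) →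
                 (∀ {x y} → T x y → f x ≡ f y) → ∀ {x y} → Star T x y → f x ≡ f y
Star-invariant f step ε        = refl
Star-invariant f step (t ◅ ts) = trans (step t) (Star-invariant f step ts)

module _ {ℓ : Level} {n : ℕ} (_≤_ : Rel (Fin n) ℓ) (D : Subset n) where

  Comparable-sym : ∀ {x y} → Comparable _≤_ D x y → Comparable _≤_ D y x
  Comparable-sym (x∈D , y∈D , inj₁ x≤y) = y∈D , x∈D , inj₂ x≤y
  Comparable-sym (x∈D , y∈D , inj₂ y≤x) = y∈D , x∈D , inj₁ y≤x

  Connected-sym : ∀ {x y} → Connected _≤_ D x y → Connected _≤_ D y x
  Connected-sym = reverse Comparable-sym

  Connected-∈ : ∀ {x y} → Connected _≤_ D x y → x ∈ D → y ∈ D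
  Connected-∈ ε                  x∈D = x∈D
  Connected-∈ ((_ , z∈D , _) ◅ p) _   = Connected-∈ p z∈D

  IsComponent-≡ : ∀ {S S′ x} → IsComponent _≤_ D S → IsComponent _≤_ D S′ →
                  x ∈ S → x ∈ S′ → S ≡ S′
  IsComponent-≡ {S} {S′} {x} (_ , _ , S-conn , S-closed) (_ , _ , S′-conn , S′-closed) x∈S x∈S′ =
    ⊆-antisym (λ {y} y∈S → S′-closed x y x∈S′ (S-conn x y x∈S y∈S))
              (λ {y} y∈S′ → S-closed x y x∈S (S′-conn x y x∈S′ y∈S′))

  component-of : ∀ {x} → x ∈ D → Decidable (Connected _≤_ D x) →
                 ∃ λ S → IsComponent _≤_ D S × x ∈ S
  component-of {x} x∈D conn? =
      S
    , ( (λ y y∈S → Connected-∈ (∈-tabulate⁻ conn? y∈S) x∈D)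
      , (x , x∈S)
      , (λ y z y∈S z∈S → Connected-sym (∈-tabulate⁻ conn? y∈S) ◅◅ ∈-tabulate⁻ conn? z∈S)
      , (λ y z y∈S y~z → ∈-tabulate⁺ conn? (∈-tabulate⁻ conn? y∈S ◅◅ y~z)))
    , x∈S
    where
    S : Subset n
    S = tabulate (does ∘ conn?)
    x∈S : x ∈ S
    x∈S = ∈-tabulate⁺ conn? ε

  antichain-comparable : ∀ {P x y} → IsAntichain _≤_ P → x ≤ y ⊎ y ≤ x → x ∈ P → y ∈ P → x ≡ y
  antichain-comparable P-anti (inj₁ x≤y) x∈P y∈P = P-anti _ _ x∈P y∈P x≤y
  antichain-comparable P-anti (inj₂ y≤x) x∈P y∈P = sym (P-anti _ _ y∈P x∈P y≤x)

  ≤-across-antichains : ∀ {P Q x y} → IsAntichain _≤_ P → IsAntichain _≤_ Q →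
                        (∀ z → z ∉ D → lookup P z ≡ lookup Q z) →
                        ¬ (x ∈ D × y ∈ D) → x ≤ y → x ∈ Q → y ∈ P → x ≡ y
  ≤-across-antichains {P} {Q} {x} {y} P-anti Q-anti P≡Q-off-D x∉D⊎y∉D x≤y x∈Q y∈P
    with x ∈? D | y ∈? D
  ... | yes x∈D | yes y∈D = contradiction (x∈D , y∈D) x∉D⊎y∉D
  ... | no x∉D  | _       = P-anti x y (lookup⇒[]= x P (trans (P≡Q-off-D x x∉D) ([]=⇒lookup x∈Q))) y∈P x≤y
  ... | _       | no y∉D  = Q-anti x y x∈Q (lookup⇒[]= y Q (trans (sym (P≡Q-off-D y y∉D)) ([]=⇒lookup y∈P))) x≤y

  SwitchRespects : (Fin n → Bool) → Set ℓ
  SwitchRespects s = ∀ {x y} → Comparable _≤_ D x y → s x ≡ s y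

  SwitchRespects-split : ∀ {s x y b} → SwitchRespects s → x ≤ y → s x ≡ b → s y ≡ not b → ¬ (x ∈ D × y ∈ D)
  SwitchRespects-split s-cong x≤y sx sy (x∈D , y∈D) = not-¬ refl (trans (sym sx) (trans (s-cong (x∈D , y∈D , inj₁ x≤y)) sy))

  switch-antichain : ∀ {P Q} (s : Fin n → Bool) → IsAntichain _≤_ P → IsAntichain _≤_ Q →
                     (∀ x → x ∉ D → lookup P x ≡ lookup Q x) → SwitchRespects s →
                     IsAntichain _≤_ (switch s P Q)
  switch-antichain {P} {Q} s P-anti Q-anti P≡Q-off-D s-cong x y x∈ y∈ x≤y
    with s x in sx | s y in sy | switch-∈ s x∈ | switch-∈ s y∈
  ... | true  | true  | x∈Q | y∈Q = Q-anti x y x∈Q y∈Q x≤y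
  ... | false | false | x∈P | y∈P = P-anti x y x∈P y∈P x≤y
  ... | true  | false | x∈Q | y∈P =
    ≤-across-antichains P-anti Q-anti P≡Q-off-D (SwitchRespects-split s-cong x≤y sx sy) x≤y x∈Q y∈P
  ... | false | true  | x∈P | y∈Q =
    ≤-across-antichains Q-anti P-anti (λ z z∉D → sym (P≡Q-off-D z z∉D)) (SwitchRespects-split s-cong x≤y sx sy)
                        x≤y x∈P y∈Q

  module _ (I : Subset n) where

    InC-xor : ∀ {A B} → InC _≤_ D I (A , B) → ∀ x → lookup A x xor lookup B x ≡ lookup D x
    InC-xor {A} {B} (_ , _ , A△B≡D , _) x = trans (sym (lookup-△ A B x)) (cong (λ S → lookup S x) A△B≡D)

    InC-∧ : ∀ {A B} → InC _≤_ D I (A , B) → ∀ x → lookup A x ∧ lookup B x ≡ lookup I x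
    InC-∧ {A} {B} (_ , _ , _ , A∩B≡I) x = trans (sym (lookup-zipWith _∧_ x A B)) (cong (λ S → lookup S x) A∩B≡I)

    InC-∈ : ∀ {A B x} → InC _≤_ D I (A , B) → x ∈ D → lookup B x ≡ not (lookup A x)
    InC-∈ {x = x} c x∈D = xor≡true⇒≡not (trans (InC-xor c x) ([]=⇒lookup x∈D))

    InC-∉ : ∀ {A B x} → InC _≤_ D I (A , B) → x ∉ D → lookup A x ≡ lookup I x × lookup B x ≡ lookup I x
    InC-∉ {x = x} c x∉D = xor≡false⇒≡∧ (trans (InC-xor c x) (∉⇒lookup≡false x∉D)) (InC-∧ c x)

    InC-proj₁-injective : ∀ {A B A′ B′} → InC _≤_ D I (A , B) → InC _≤_ D I (A′ , B′) →
                          A ≡ A′ → (A , B) ≡ (A′ , B′)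
    InC-proj₁-injective {A} {B} {_} {B′} c c′ refl = cong (A ,_) (subset-ext λ x → by-cases x (x ∈? D))
      where
      by-cases : ∀ x → Dec (x ∈ D) → lookup B x ≡ lookup B′ x
      by-cases x (yes x∈D) = trans (InC-∈ c x∈D) (sym (InC-∈ c′ x∈D))
      by-cases x (no x∉D)  = trans (proj₂ (InC-∉ c x∉D)) (sym (proj₂ (InC-∉ c′ x∉D)))

    InC-Comparable : ∀ {A B x y} → InC _≤_ D I (A , B) → Comparable _≤_ D x y → x ≢ y →
                     lookup A x ≡ not (lookup A y)
    InC-Comparable {A} {B} {x} {y} c@(A-anti , B-anti , _) (x∈D , y∈D , x~y) x≢y
      with lookup A x in Ax | lookup A y in Ay
    ... | true  | false = refl
    ... | false | true  = refl
    ... | true  | true  = contradiction (antichain-comparable A-anti x~y (lookup⇒[]= x A Ax) (lookup⇒[]= y A Ay)) x≢y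
    ... | false | false = contradiction (antichain-comparable B-anti x~y (∈B x∈D Ax) (∈B y∈D Ay)) x≢y
      where
      ∈B : ∀ {z} → z ∈ D → lookup A z ≡ false → z ∈ B
      ∈B {z} z∈D Az = lookup⇒[]= z B (trans (InC-∈ c z∈D) (cong not Az))

    InC-Connected-xor : ∀ {A B A′ B′} → InC _≤_ D I (A , B) → InC _≤_ D I (A′ , B′) →
                        ∀ {x y} → Connected _≤_ D x y → lookup A x xor lookup A′ x ≡ lookup A y xor lookup A′ y
    InC-Connected-xor {A} {_} {A′} c c′ = Star-invariant (λ z → lookup A z xor lookup A′ z) step
      where
      step : ∀ {x y} → Comparable _≤_ D x y → lookup A x xor lookup A′ x ≡ lookup A y xor lookup A′ y
      step {x} {y} x~y with x ≟ y
      ... | yes refl = refl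
      ... | no x≢y   = begin
        lookup A x xor lookup A′ x             ≡⟨ cong₂ _xor_ (InC-Comparable c x~y x≢y) (InC-Comparable c′ x~y x≢y) ⟩
        not (lookup A y) xor not (lookup A′ y) ≡⟨ xor-annihilates-not (lookup A y) (lookup A′ y) ⟩
        lookup A y xor lookup A′ y             ∎
        where open ≡-Reasoning

    InC-switch : ∀ {A B} s → InC _≤_ D I (A , B) → SwitchRespects s →
                 InC _≤_ D I (switch s A B , switch s B A)
    InC-switch {A} {B} s c@(A-anti , B-anti , A△B≡D , A∩B≡I) s-cong =
        switch-antichain s A-anti B-anti A≡B-off-D s-cong
      , switch-antichain s B-anti A-anti (λ x x∉D → sym (A≡B-off-D x x∉D)) s-cong
      , trans (switch-△-switch s A B) A△B≡D
      , trans (switch-∩-switch s A B) A∩B≡I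
      where
      A≡B-off-D : ∀ x → x ∉ D → lookup A x ≡ lookup B x
      A≡B-off-D x x∉D = let (A≡I , B≡I) = InC-∉ c x∉D in trans A≡I (sym B≡I)

    switch-∈D : ∀ {A B x} s → InC _≤_ D I (A , B) → x ∈ D → lookup (switch s A B) x ≡ s x xor lookup A x
    switch-∈D {A} {B} {x} s c x∈D = begin
      lookup (switch s A B) x                        ≡⟨ lookup-switch s A B x ⟩
      (if s x then lookup B x else lookup A x)       ≡⟨ cong (if s x then_else lookup A x) (InC-∈ c x∈D) ⟩
      (if s x then not (lookup A x) else lookup A x) ≡⟨ if-not≡xor (s x) (lookup A x) ⟩
      s x xor lookup A x                             ∎
      where open ≡-Reasoning

    switch-∉D : ∀ {A B x} s → InC _≤_ D I (A , B) → x ∉ D → lookup (switch s A B) x ≡ lookup I x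
    switch-∉D {A} {B} {x} s c x∉D =
      let (A≡I , B≡I) = InC-∉ c x∉D in trans (lookup-switch s A B x) (if-≡ (s x) A≡I B≡I)

module Components {ℓ : Level} {n : ℕ} (_≤_ : Rel (Fin n) ℓ) (D : Subset n)
  (Ks : List (Subset n)) (Ks-unique : Unique Ks)
  (Ks-components : ∀ S → (S L.∈ Ks) ⇔ IsComponent _≤_ D S) where

  K : Fin (length Ks) → Subset n
  K = List.lookup Ks

  K-component : ∀ i → IsComponent _≤_ D (K i)
  K-component i = Equivalence.to (Ks-components (K i)) (∈-lookup i)

  representative : Fin (length Ks) → Fin n
  representative i = proj₁ (proj₁ (proj₂ (K-component i)))

  representative-∈ : ∀ i → representative i ∈ K i
  representative-∈ i = proj₂ (proj₁ (proj₂ (K-component i)))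

  K-connected : ∀ i {x y} → x ∈ K i → y ∈ K i → Connected _≤_ D x y
  K-connected i {x} {y} = proj₁ (proj₂ (proj₂ (K-component i))) x y

  K-closed : ∀ i {x y} → x ∈ K i → Connected _≤_ D x y → y ∈ K i
  K-closed i {x} {y} = proj₂ (proj₂ (proj₂ (K-component i))) x y

  K-disjoint : ∀ {i j x} → x ∈ K i → x ∈ K j → i ≡ j
  K-disjoint {i} {j} x∈Ki x∈Kj =
    Unique-lookup-injective Ks-unique i j (IsComponent-≡ _≤_ D (K-component i) (K-component j) x∈Ki x∈Kj)

  -- Connectedness need not be decidable, but a component containing x exists under double
  -- negation, and membership in some K i is decidable.
  K-cover : ∀ {x} → x ∈ D → ∃ λ i → x ∈ K i
  K-cover {x} x∈D = decidable-stable (any? λ i → x ∈? K i) λ ∄i →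
    ¬¬-decidable {P = Connected _≤_ D x} λ conn? →
      let (S , S-component , x∈S) = component-of _≤_ D x∈D conn?
          S∈Ks = Equivalence.from (Ks-components S) S-component
      in ∄i (index S∈Ks , subst (x ∈_) (lookup-index S∈Ks) x∈S)

  selected : Subset (length Ks) → Fin n → Bool
  selected T x = does (any? λ i → (i ∈? T) ×-dec (x ∈? K i))

  selected-∈ : ∀ T {i x} → x ∈ K i → selected T x ≡ lookup T i
  selected-∈ T {i} {x} x∈Ki with any? (λ j → (j ∈? T) ×-dec (x ∈? K j))
  ... | yes (j , j∈T , x∈Kj) = sym ([]=⇒lookup (subst (_∈ T) (K-disjoint x∈Kj x∈Ki) j∈T))
  ... | no ∄j                = sym (∉⇒lookup≡false λ i∈T → ∄j (i , i∈T , x∈Ki))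

  selected-respects : ∀ T → SwitchRespects _≤_ D (selected T)
  selected-respects T x~y@(x∈D , _ , _) =
    let (i , x∈Ki) = K-cover x∈D
    in trans (selected-∈ T x∈Ki) (sym (selected-∈ T (K-closed i x∈Ki (x~y ◅ ε))))

  module _ (I : Subset n) {A₀ B₀ : Subset n} (c₀ : InC _≤_ D I (A₀ , B₀)) where

    switched : Subset (length Ks) → Subset n × Subset n
    switched T = switch (selected T) A₀ B₀ , switch (selected T) B₀ A₀

    switched-InC : ∀ T → InC _≤_ D I (switched T)
    switched-InC T = InC-switch _≤_ D I (selected T) c₀ (selected-respects T)

    switched-representative : ∀ T i → lookup (proj₁ (switched T)) (representative i) xor lookup A₀ (representative i)
                                      ≡ lookup T i
    switched-representative T i = begin
      lookup (proj₁ (switched T)) r xor lookup A₀ r     ≡⟨ cong (_xor lookup A₀ r) (switch-∈D _≤_ D I (selected T) c₀ r∈D) ⟩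
      (selected T r xor lookup A₀ r) xor lookup A₀ r    ≡⟨ xor-cancelʳ (selected T r) (lookup A₀ r) ⟩
      selected T r                                      ≡⟨ selected-∈ T (representative-∈ i) ⟩
      lookup T i                                        ∎
      where
      open ≡-Reasoning
      r : Fin n
      r = representative i
      r∈D : r ∈ D
      r∈D = proj₁ (K-component i) r (representative-∈ i)

    switched-injective : Injective _≡_ _≡_ switched
    switched-injective {T} {T′} eq = subset-ext λ i →
      trans (sym (switched-representative T i))
            (trans (cong (λ AB → lookup (proj₁ AB) (representative i) xor lookup A₀ (representative i)) eq)
                   (switched-representative T′ i))

    -- T records, for each component, whether A differs from A₀ on it.
    switched-surjective : ∀ AB → InC _≤_ D I AB → ∃ λ T → switched T ≡ AB
    switched-surjective (A , B) c = T , InC-proj₁-injective _≤_ D I (switched-InC T) c (subset-ext agrees)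
      where
      T : Subset (length Ks)
      T = tabulate λ i → lookup A (representative i) xor lookup A₀ (representative i)

      agrees-on-component : ∀ {i x} → x ∈ K i → lookup (switch (selected T) A₀ B₀) x ≡ lookup A x
      agrees-on-component {i} {x} x∈Ki = begin
        lookup (switch (selected T) A₀ B₀) x          ≡⟨ switch-∈D _≤_ D I (selected T) c₀ x∈D ⟩
        selected T x xor lookup A₀ x                 ≡⟨ cong (_xor lookup A₀ x) (selected-∈ T x∈Ki) ⟩
        lookup T i xor lookup A₀ x                   ≡⟨ cong (_xor lookup A₀ x) (lookup∘tabulate _ i) ⟩
        (lookup A r xor lookup A₀ r) xor lookup A₀ x ≡⟨ cong (_xor lookup A₀ x) r~x ⟩
        (lookup A x xor lookup A₀ x) xor lookup A₀ x ≡⟨ xor-cancelʳ (lookup A x) (lookup A₀ x) ⟩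
        lookup A x                                   ∎
        where
        open ≡-Reasoning
        x∈D : x ∈ D
        x∈D = proj₁ (K-component i) x x∈Ki
        r : Fin n
        r = representative i
        r~x : lookup A r xor lookup A₀ r ≡ lookup A x xor lookup A₀ x
        r~x = InC-Connected-xor _≤_ D I c c₀ (K-connected i (representative-∈ i) x∈Ki)

      agrees : ∀ x → lookup (switch (selected T) A₀ B₀) x ≡ lookup A x
      agrees x with x ∈? D
      ... | yes x∈D = agrees-on-component (proj₂ (K-cover x∈D))
      ... | no x∉D  = trans (switch-∉D _≤_ D I (selected T) c₀ x∉D) (sym (proj₁ (InC-∉ _≤_ D I c x∉D)))

lemma4 : {ℓ : Level} (n : ℕ) (_≤_ : Rel (Fin n) ℓ) → IsPartialOrder _≡_ _≤_ →
         (D I : Subset n) → (∀ x → x ∈ I → x ∉ D) →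
         (∃ λ AB → InC _≤_ D I AB) →
         (Ks : List (Subset n)) → Unique Ks →
         (∀ S → (S L.∈ Ks) ⇔ IsComponent _≤_ D S) →
         Σ (Subset (length Ks) → Subset n × Subset n) λ f →
           (∀ T → InC _≤_ D I (f T)) ×
           Injective _≡_ _≡_ f ×
           (∀ AB → InC _≤_ D I AB → ∃ λ T → f T ≡ AB)
lemma4 n _≤_ _ D I _ (_ , c₀) Ks Ks-unique Ks-components =
  switched I c₀ , switched-InC I c₀ , switched-injective I c₀ , switched-surjective I c₀
  where open Components _≤_ D Ks Ks-unique Ks-components
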